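{- Let $(G,Z,k)$ be a yes-instance of Disjoint $d$-quasi-forest deletion. Then for each vertex $u \in Z$, there are at most $k+d$ connected components of $G - Z$ that are adjacent to $u$ and contain at least one cycle.
   Context: A $d$-quasi-forest is a graph in which each connected component admits a feedback vertex set of size at most $d$. Disjoint $d$-quasi-forest deletion: the input is a graph $G$, an integer $k$, and a set $Z \subseteq V(G)$ with $|Z| \le k+1$ such that $G - Z$ is a $d$-quasi-forest ($d$ fixed); it is a yes-instance iff there is $X \subseteq V(G)$ with $|X| \le k$ and $X \cap Z = \emptyset$ such that $G - X$ is a $d$-quasi-forest. -}

module Defs where

open import Data.Nat using (ℕ; zero; suc; _+_; _≤_)
open import Data.Fin using (Fin; toℕ; fromℕ) renaming (zero to fzero)
open import Data.Fin.Subset using (Subset; _∈_; _∉_; ∣_∣; _∩_; Empty)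
open import Data.Product using (Σ; _×_; ∃; ∃-syntax; _,_)
open import Data.Empty using (⊥)
open import Function.Definitions using (Injective)
open import Relation.Nullary using (¬_)
open import Relation.Binary.PropositionalEquality using (_≡_)

record Graph (n : ℕ) : Set₁ where
  field
    E     : Fin n → Fin n → Set
    sym   : ∀ {u v} → E u v → E v u
    irrfl : ∀ {u} → ¬ E u u
open Graph public

module _ {n : ℕ} (G : Graph n) where

  -- Throughout, S : Subset n is the vertex set of the induced subgraph G[S].
  -- (G - X is G[S] with S the complement of X.)

  data Reach (S : Subset n) (v : Fin n) : Fin n → Set where
    here : v ∈ S → Reach S v v
    step : ∀ {x w} → Reach S v x → E G x w → w ∈ S → Reach S v w

  record Cycle (S : Subset n) : Set where
    field
      m      : ℕ
      c      : Fin (3 + m) → Fin n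
      inj    : Injective _≡_ _≡_ c
      inS    : ∀ i → c i ∈ S
      adj    : ∀ i j → toℕ j ≡ suc (toℕ i) → E G (c i) (c j)
      close  : E G (c (fromℕ (2 + m))) (c fzero)
  open Cycle public

  -- The connected component of G[S] containing v (v ∈ S) admits a feedback
  -- vertex set of size at most d: a set F of vertices of that component with
  -- |F| ≤ d such that the component minus F contains no cycle.
  CompHasFVS : ℕ → Subset n → Fin n → Set
  CompHasFVS d S v =
    ∃[ F ] (∣ F ∣ ≤ d) × (∀ f → f ∈ F → Reach S v f) ×
      ((C : Cycle S) → ¬ (∀ i → Reach S v (c C i) × c C i ∉ F))

  QuasiForest : ℕ → Subset n → Set
  QuasiForest d S = ∀ v → v ∈ S → CompHasFVS d S v

  minus : Subset n → Subset n
  minus X = Data.Fin.Subset.∁ X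

  ValidInstance : ℕ → Subset n → ℕ → Set
  ValidInstance d Z k = (∣ Z ∣ ≤ suc k) × QuasiForest d (minus Z)

  YesInstance : ℕ → Subset n → ℕ → Set
  YesInstance d Z k =
    ValidInstance d Z k ×
    (∃[ X ] (∣ X ∣ ≤ k) × Empty (X ∩ Z) × QuasiForest d (minus X))

  CompAdjCyclic : Subset n → Fin n → Fin n → Set
  CompAdjCyclic S u v =
    (∃[ w ] Reach S v w × E G u w) ×
    (Σ (Cycle S) λ C → ∀ i → Reach S v (c C i))

module Submission where

-- Let X be a solution (|X| ≤ k, X ∩ Z = ∅, G - X a d-quasi-forest)
-- and let u ∈ Z.  Since u ∉ X, the component of u in G - X has a feedback
-- vertex set F with |F| ≤ d.  Every component K of G - Z that is adjacent to u
-- and contains a cycle C meets X ∪ F: if K avoids X, then the walks in K from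
-- the neighbour of u to the vertices of C survive in G - X, so C is a cycle of
-- the component of u in G - X and therefore meets F.  Choosing one vertex of
-- X ∪ F in each of m pairwise distinct such components gives an injection
-- Fin m → X ∪ F, whence m ≤ |X ∪ F| ≤ |X| + |F| ≤ k + d.

open import Defs
open import Data.Nat using (ℕ; _+_; _≤_)
open import Data.Fin using (Fin)
open import Data.Fin.Subset using (Subset; _∈_)
open import Data.Product using (_×_)
open import Relation.Nullary using (¬_)
open import Relation.Binary.PropositionalEquality using (_≢_)

open import Data.Nat using (zero; suc; z≤n; s≤s)
open import Data.Nat.Properties using (+-mono-≤; +-monoʳ-≤; +-suc; ≤-trans; ≤-reflexive; module ≤-Reasoning)
open import Data.Fin using () renaming (zero to fzero; suc to fsuc)
open import Data.Fin.Properties using (suc-injective; any?) renaming (_≟_ to _≟ᶠ_)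
open import Data.Fin.Subset using (_∉_; ∁; ∣_∣; _-_; _∪_; outside; inside)
open import Data.Fin.Subset.Properties
  using (_∈?_; x∉p⇒x∈∁p; x∈p∧x≢y⇒x∈p-y; x∈p⇒∣p-x∣<∣p∣; ∣p∣≤∣x∷p∣; x∈p∩q⁺; x∈p∪q⁺)
open import Data.Vec using ([]; _∷_)
open import Data.Product using (∃-syntax; _,_; proj₁; proj₂)
open import Data.Sum using (_⊎_; inj₁; inj₂; map₁)
open import Data.Empty using (⊥-elim)
open import Relation.Nullary using (yes; no)
open import Relation.Binary.PropositionalEquality using (_≡_; subst) renaming (sym to ≡-sym)
open import Function.Definitions using (Injective)

∣p∪q∣≤∣p∣+∣q∣ : ∀ {n} (p q : Subset n) → ∣ p ∪ q ∣ ≤ ∣ p ∣ + ∣ q ∣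
∣p∪q∣≤∣p∣+∣q∣ []            []            = z≤n
∣p∪q∣≤∣p∣+∣q∣ (inside  ∷ p) (t       ∷ q) = s≤s (≤-trans (∣p∪q∣≤∣p∣+∣q∣ p q) (+-monoʳ-≤ ∣ p ∣ (∣p∣≤∣x∷p∣ t q)))
∣p∪q∣≤∣p∣+∣q∣ (outside ∷ p) (inside  ∷ q) = ≤-trans (s≤s (∣p∪q∣≤∣p∣+∣q∣ p q)) (≤-reflexive (≡-sym (+-suc ∣ p ∣ ∣ q ∣)))
∣p∪q∣≤∣p∣+∣q∣ (outside ∷ p) (outside ∷ q) = ∣p∪q∣≤∣p∣+∣q∣ p q

injection⇒≤∣S∣ : ∀ {m n} (S : Subset n) (f : Fin m → Fin n) →
                 Injective _≡_ _≡_ f → (∀ i → f i ∈ S) → m ≤ ∣ S ∣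
injection⇒≤∣S∣ {zero}  S f f-inj f∈S = z≤n
injection⇒≤∣S∣ {suc m} S f f-inj f∈S =
  ≤-trans (s≤s (injection⇒≤∣S∣ (S - f fzero) (λ i → f (fsuc i)) rest-inj rest∈))
          (x∈p⇒∣p-x∣<∣p∣ (f∈S fzero))
  where
  rest-inj : Injective _≡_ _≡_ (λ i → f (fsuc i))
  rest-inj eq = suc-injective (f-inj eq)
  suc≢zero : ∀ {i : Fin m} → fsuc i ≢ fzero
  suc≢zero ()
  rest∈ : ∀ i → f (fsuc i) ∈ S - f fzero
  rest∈ i = x∈p∧x≢y⇒x∈p-y (f∈S (fsuc i)) (λ eq → suc≢zero (f-inj eq))

-- Finite search with a pointwise dichotomy: either some index satisfies P, or
-- all indices satisfy Q.  Used where Q is not the negation of a decidable P.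
searchFin : ∀ k (P Q : Fin k → Set) → (∀ j → P j ⊎ Q j) → (∃[ j ] P j) ⊎ (∀ j → Q j)
searchFin zero    P Q pq = inj₂ (λ ())
searchFin (suc k) P Q pq with pq fzero | searchFin k (λ j → P (fsuc j)) (λ j → Q (fsuc j)) (λ j → pq (fsuc j))
... | inj₁ p₀ | _              = inj₁ (fzero , p₀)
... | inj₂ _  | inj₁ (j , p)   = inj₁ (fsuc j , p)
... | inj₂ q₀ | inj₂ q         = inj₂ λ { fzero → q₀ ; (fsuc j) → q j }

module Walks {n : ℕ} (G : Graph n) where

  start∈ : ∀ {S v w} → Reach G S v w → v ∈ S
  start∈ (here v∈S)   = v∈S
  start∈ (step p _ _) = start∈ p

  end∈ : ∀ {S v w} → Reach G S v w → w ∈ S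
  end∈ (here v∈S)     = v∈S
  end∈ (step _ _ w∈S) = w∈S

  _⨾_ : ∀ {S v w x} → Reach G S v w → Reach G S w x → Reach G S v x
  p ⨾ here _       = p
  p ⨾ step q e x∈S = step (p ⨾ q) e x∈S

  reverse : ∀ {S v w} → Reach G S v w → Reach G S w v
  reverse (here v∈S)     = here v∈S
  reverse (step p e w∈S) = step (here w∈S) (Graph.sym G e) (end∈ p) ⨾ reverse p

  meetsOrAvoids : ∀ {S v w} (X : Subset n) → Reach G S v w →
                  (∃[ x ] x ∈ X × Reach G S v x) ⊎ Reach G (∁ X) v w
  meetsOrAvoids {v = v} X (here v∈S) with v ∈? X
  ... | yes v∈X = inj₁ (v , v∈X , here v∈S)
  ... | no  v∉X = inj₂ (here (x∉p⇒x∈∁p v∉X))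
  meetsOrAvoids {w = w} X (step p e w∈S) with meetsOrAvoids X p | w ∈? X
  ... | inj₁ hit | _       = inj₁ hit
  ... | inj₂ q   | yes w∈X = inj₁ (w , w∈X , step p e w∈S)
  ... | inj₂ q   | no  w∉X = inj₂ (step q e (x∉p⇒x∈∁p w∉X))

  componentMeetsOrAvoids : ∀ {S a k} (X : Subset n) (t : Fin k → Fin n) →
    (∀ j → Reach G S a (t j)) →
    (∃[ x ] x ∈ X × Reach G S a x) ⊎ (∀ j → Reach G (∁ X) a (t j))
  componentMeetsOrAvoids {S} {a} {k} X t walks = map₁ proj₂
    (searchFin k (λ _ → ∃[ x ] x ∈ X × Reach G S a x) (λ j → Reach G (∁ X) a (t j))
                 (λ j → meetsOrAvoids X (walks j)))

  restrictCycle : ∀ {S T} (C : Cycle G S) → (∀ i → c C i ∈ T) → Cycle G T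
  restrictCycle C inT = record
    { m = m C ; c = c C ; inj = inj C ; inS = inT ; adj = adj C ; close = close C }

  -- F meets every cycle of the component of u in G[S]; this is the cycle
  -- condition in the definition of a feedback vertex set of that component.
  MeetsAllCycles : Subset n → Fin n → Subset n → Set
  MeetsAllCycles S u F = (C : Cycle G S) → ¬ (∀ i → Reach G S u (c C i) × c C i ∉ F)

  cyclicComponentMeets : ∀ {S X F u v} → u ∈ ∁ X → MeetsAllCycles (∁ X) u F →
    CompAdjCyclic G S u v → ∃[ y ] Reach G S v y × (y ∈ X ⊎ y ∈ F)
  cyclicComponentMeets {X = X} {F} {u} u∈∁X meetsF ((w , v⇝w , uw) , (C , v⇝C))
    with componentMeetsOrAvoids X (c C) (λ j → reverse v⇝w ⨾ v⇝C j)
  ... | inj₁ (x , x∈X , w⇝x) = x , v⇝w ⨾ w⇝x , inj₁ x∈X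
  ... | inj₂ w⇝C with any? (λ j → c C j ∈? F)
  ...   | yes (j , cj∈F) = c C j , v⇝C j , inj₂ cj∈F
  ...   | no  noneInF    = ⊥-elim (meetsF C′ λ j → u⇝C j , λ cj∈F → noneInF (j , cj∈F))
    where
    -- C avoids X, so it is a cycle of G - X lying in the component of u.
    C′ : Cycle G (∁ X)
    C′ = restrictCycle C (λ j → end∈ (w⇝C j))
    u⇝C : ∀ j → Reach G (∁ X) u (c C j)
    u⇝C j = step (here u∈∁X) uw (start∈ (w⇝C j)) ⨾ w⇝C j

  separatedChoiceInjective : ∀ {S m} (r φ : Fin m → Fin n) →
    (∀ i → Reach G S (r i) (φ i)) → (∀ i j → i ≢ j → ¬ Reach G S (r i) (r j)) →
    Injective _≡_ _≡_ φ
  separatedChoiceInjective {S} r φ r⇝φ separated {i} {j} φi≡φj with i ≟ᶠ j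
  ... | yes i≡j = i≡j
  ... | no  i≢j = ⊥-elim (separated i j i≢j
                    (r⇝φ i ⨾ reverse (subst (Reach G S (r j)) (≡-sym φi≡φj) (r⇝φ j))))

open Walks

lemma5 : (d n : ℕ) (G : Graph n) (Z : Subset n) (k : ℕ) →
    YesInstance G d Z k →
    (u : Fin n) → u ∈ Z →
    (m : ℕ) (r : Fin m → Fin n) →
    (∀ i → CompAdjCyclic G (minus G Z) u (r i)) →
    (∀ i j → i ≢ j → ¬ Reach G (minus G Z) (r i) (r j)) →
    m ≤ k + d
lemma5 d n G Z k (_ , X , ∣X∣≤k , X∩Z=∅ , forestX) u u∈Z m r adjCyclic separated = begin
    m             ≤⟨ injection⇒≤∣S∣ (X ∪ F) φ φ-inj (λ i → x∈p∪q⁺ (proj₂ (proj₂ (hit i)))) ⟩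
    ∣ X ∪ F ∣     ≤⟨ ∣p∪q∣≤∣p∣+∣q∣ X F ⟩
    ∣ X ∣ + ∣ F ∣ ≤⟨ +-mono-≤ ∣X∣≤k ∣F∣≤d ⟩
    k + d         ∎
  where
  open ≤-Reasoning
  u∈∁X : u ∈ ∁ X
  u∈∁X = x∉p⇒x∈∁p (λ u∈X → X∩Z=∅ (u , x∈p∩q⁺ (u∈X , u∈Z)))
  fvs : CompHasFVS G d (∁ X) u
  fvs = forestX u u∈∁X
  F : Subset n
  F = proj₁ fvs
  ∣F∣≤d : ∣ F ∣ ≤ d
  ∣F∣≤d = proj₁ (proj₂ fvs)
  hit : ∀ i → ∃[ y ] Reach G (∁ Z) (r i) y × (y ∈ X ⊎ y ∈ F)
  hit i = cyclicComponentMeets G u∈∁X (proj₂ (proj₂ (proj₂ fvs))) (adjCyclic i)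
  φ : Fin m → Fin n
  φ i = proj₁ (hit i)
  φ-inj : Injective _≡_ _≡_ φ
  φ-inj = separatedChoiceInjective G r φ (λ i → proj₁ (proj₂ (hit i))) separated
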